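{- Let $(P,\leq)$ be a poset, $f \in \operatorname{Aut}(P)$, and $x,y \in P$ with $x \sim_f y$. Then $\operatorname{par}(x,f) = \operatorname{par}(y,f)$. Moreover, if this common parity is $0$, then $\operatorname{sp}(x,f) = \operatorname{sp}(y,f)$.
   Context: $x\sim_f y$ iff $f^i(x)\le y\le f^j(x)$ for some $i,j\in\mathbb{Z}$. The spiral length $\operatorname{sp}(x,f)$ is the least $n\ge1$ such that $x$ and $f^n(x)$ are comparable, or $\infty$; parity $\operatorname{par}(x,f)$ is $+1$ if $\operatorname{sp}(x,f)<\infty$ and $x<f^{\operatorname{sp}(x,f)}(x)$, $-1$ if $\operatorname{sp}(x,f)<\infty$ and $x>f^{\operatorname{sp}(x,f)}(x)$, and $0$ otherwise. -}

module Defs where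

open import Level using (Level; _⊔_)
open import Data.Nat using (ℕ; zero; suc; _<_; _≥_)
open import Data.Integer using (ℤ; +_; -[1+_]) renaming (_<_ to _<ℤ_)
open import Data.Maybe using (Maybe; just; nothing)
open import Data.Product using (Σ; _×_; _,_; ∃-syntax)
open import Data.Sum using (_⊎_)
open import Relation.Nullary using (¬_)
open import Relation.Binary.Bundles using (Poset)

record Aut {c ℓ₁ ℓ₂ : Level} (P : Poset c ℓ₁ ℓ₂) : Set (c ⊔ ℓ₁ ⊔ ℓ₂) where
  open Poset P using (Carrier; _≈_; _≤_)
  field
    to        : Carrier → Carrier
    from      : Carrier → Carrier
    to-from   : ∀ x → to (from x) ≈ x
    from-to   : ∀ x → from (to x) ≈ x
    to-mono   : ∀ {x y} → x ≤ y → to x ≤ to y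
    to-refl   : ∀ {x y} → to x ≤ to y → x ≤ y

module _ {c ℓ₁ ℓ₂ : Level} {P : Poset c ℓ₁ ℓ₂} (f : Aut P) where
  open Poset P using (Carrier; _≈_; _≤_)
  open Aut f

  iterℕ : (Carrier → Carrier) → ℕ → Carrier → Carrier
  iterℕ h zero x = x
  iterℕ h (suc n) x = h (iterℕ h n x)

  pow : ℤ → Carrier → Carrier
  pow (+ n) x = iterℕ to n x
  pow -[1+ n ] x = iterℕ from (suc n) x

  Related : Carrier → Carrier → Set ℓ₂
  Related x y = Σ ℤ λ i → Σ ℤ λ j → (pow i x ≤ y) × (y ≤ pow j x)

  Comparable : Carrier → Carrier → Set ℓ₂
  Comparable a b = (a ≤ b) ⊎ (b ≤ a)

  _<P_ : Carrier → Carrier → Set (ℓ₁ ⊔ ℓ₂)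
  a <P b = (a ≤ b) × ¬ (a ≈ b)

  IsSp : Carrier → ℕ → Set ℓ₂
  IsSp x n = (n ≥ 1) × Comparable x (pow (+ n) x)
             × (∀ m → m ≥ 1 → m < n → ¬ Comparable x (pow (+ m) x))

  -- Sp x s : sp(x,f) = s, where nothing encodes ∞
  Sp : Carrier → Maybe ℕ → Set ℓ₂
  Sp x (just n) = IsSp x n
  Sp x nothing  = ∀ n → n ≥ 1 → ¬ Comparable x (pow (+ n) x)

  data Par (x : Carrier) : ℤ → Set (ℓ₁ ⊔ ℓ₂) where
    par+ : ∀ n → IsSp x n → x <P pow (+ n) x → Par x (+ 1)
    par- : ∀ n → IsSp x n → pow (+ n) x <P x → Par x -[1+ 0 ]
    par0-∞ : Sp x nothing → Par x (+ 0)
    par0-≈ : ∀ n → IsSp x n → x ≈ pow (+ n) x → Par x (+ 0)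

-- Write t for f and tⁿ for its iterates. Say u rises if u ≤ tᵐu, and falls if tᵐu ≤ u, for some
-- m ≥ 1; parity +1, -1 and 0 say that x rises only, falls only, or rises iff it falls. If x ∼ y then
-- tᵃx ≤ tᵉy ≤ tᵇx for some a, e, b ≥ 0, and rising passes along such a sandwich: enough periods of
-- the rise of x carry tᵇx above a shift of tᵃx. Falling is the dual statement. If x both rises and
-- falls, every comparability tᵃx ≤ tᵇx between its iterates reverses, so x is comparable with tⁿx
-- exactly when y is comparable with tⁿy, and the spiral lengths agree; if x does neither, both
-- spiral lengths are infinite.
module Submission where

open import Defs
open import Level using (Level; _⊔_)
open import Data.Nat using (ℕ; zero; suc; _+_; _*_; _<_; _≥_; s≤s; z≤n)
open import Data.Nat.Properties using (+-comm; *-comm; *-suc; <-cmp)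
open import Data.Nat.GeneralisedArithmetic using (fold; fold-+)
open import Data.Nat.Tactic.RingSolver using (solve-∀)
open import Data.Integer using (ℤ; +_; -[1+_])
open import Data.Maybe using (Maybe; just; nothing)
open import Data.Product using (∃-syntax; _×_; _,_)
open import Data.Sum using (_⊎_; inj₁; inj₂; [_,_]′)
open import Data.Empty using (⊥-elim)
open import Function using (_∘_; const)
open import Function.Bundles using (_⇔_; mk⇔; Equivalence)
open import Relation.Nullary using (¬_)
open import Relation.Binary using (tri<; tri≈; tri>)
open import Relation.Binary.Bundles using (Poset)
open import Relation.Binary.PropositionalEquality using (_≡_; refl; sym; trans; cong; subst)
import Relation.Binary.Construct.Flip.EqAndOrd as Flip
import Relation.Binary.Reasoning.PartialOrder as ≤-Reasoning

module Iteration {c ℓ₁ ℓ₂ : Level} (P : Poset c ℓ₁ ℓ₂) (t : Poset.Carrier P → Poset.Carrier P)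
  (t-mono : ∀ {u v} → Poset._≤_ P u v → Poset._≤_ P (t u) (t v))
  (t-reflect : ∀ {u v} → Poset._≤_ P (t u) (t v) → Poset._≤_ P u v) where

  open Poset P using (Carrier; _≤_) renaming (refl to ≤-refl)
  open ≤-Reasoning P

  iter : ℕ → Carrier → Carrier
  iter n u = fold u t n

  iter-+ : ∀ m n u → iter (m + n) u ≡ iter m (iter n u)
  iter-+ m n u = fold-+ u t m

  iter-comm : ∀ m n u → iter m (iter n u) ≡ iter n (iter m u)
  iter-comm m n u = trans (sym (iter-+ m n u)) (trans (cong (λ k → iter k u) (+-comm m n)) (iter-+ n m u))

  iter-mono : ∀ n {u v} → u ≤ v → iter n u ≤ iter n v
  iter-mono zero    u≤v = u≤v
  iter-mono (suc n) u≤v = t-mono (iter-mono n u≤v)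

  iter-reflect : ∀ n {u v} → iter n u ≤ iter n v → u ≤ v
  iter-reflect zero    ≤ⁿ = ≤ⁿ
  iter-reflect (suc n) ≤ⁿ = iter-reflect n (t-reflect ≤ⁿ)

  ≤-iter-* : ∀ {u} m → u ≤ iter m u → ∀ k → u ≤ iter (k * m) u
  ≤-iter-* m u≤ zero = ≤-refl
  ≤-iter-* {u} m u≤ (suc k) = begin
    u                       ≤⟨ u≤ ⟩
    iter m u                ≤⟨ iter-mono m (≤-iter-* m u≤ k) ⟩
    iter m (iter (k * m) u) ≡⟨ iter-+ m (k * m) u ⟨
    iter (m + k * m) u      ∎

  Rises : Carrier → Set ℓ₂
  Rises u = ∃[ m ] u ≤ iter (suc m) u

  rises-at : ∀ {n u} → n ≥ 1 → u ≤ iter n u → Rises u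
  rises-at {suc m} _ u≤ = m , u≤

  Sandwiched : Carrier → Carrier → Set ℓ₂
  Sandwiched x y = ∃[ a ] ∃[ e ] ∃[ b ] iter a x ≤ iter e y × iter e y ≤ iter b x

  sandwiched : ∀ {x y} → ∃[ a ] ∃[ c ] iter a x ≤ iter c y → ∃[ d ] ∃[ b ] iter d y ≤ iter b x →
               Sandwiched x y
  sandwiched {x} {y} (a , c , below) (d , b , above) = d + a , d + c , c + b ,
    (begin
      iter (d + a) x    ≡⟨ iter-+ d a x ⟩
      iter d (iter a x) ≤⟨ iter-mono d below ⟩
      iter d (iter c y) ≡⟨ iter-+ d c y ⟨
      iter (d + c) y    ∎) ,
    (begin
      iter (d + c) y    ≡⟨ cong (λ k → iter k y) (+-comm d c) ⟩
      iter (c + d) y    ≡⟨ iter-+ c d y ⟩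
      iter c (iter d y) ≤⟨ iter-mono c above ⟩
      iter c (iter b x) ≡⟨ iter-+ c b x ⟨
      iter (c + b) x    ∎)

  sandwiched-sym : ∀ {x y} → Sandwiched x y → Sandwiched y x
  sandwiched-sym (a , e , b , below , above) = sandwiched (e , b , above) (a , e , below)

  rises-transfer : ∀ {x y} → Sandwiched x y → Rises x → Rises y
  rises-transfer {x} {y} (a , e , b , below , above) (m , x≤) = N , iter-reflect e (begin
    iter e y                        ≤⟨ above ⟩
    iter b x                        ≤⟨ iter-mono b (≤-iter-* (suc m) x≤ (suc a)) ⟩
    iter b (iter (suc a * suc m) x) ≡⟨ iter-+ b (suc a * suc m) x ⟨
    iter (b + suc a * suc m) x      ≡⟨ cong (λ k → iter k x) (exponents a b m) ⟩
    iter (suc N + a) x              ≡⟨ iter-+ (suc N) a x ⟩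
    iter (suc N) (iter a x)         ≤⟨ iter-mono (suc N) below ⟩
    iter (suc N) (iter e y)         ≡⟨ iter-comm (suc N) e y ⟩
    iter e (iter (suc N) y)         ∎)
    where
    N : ℕ
    N = b + a * m + m
    exponents : ∀ a b m → b + suc a * suc m ≡ suc (b + a * m + m) + a
    exponents = solve-∀

module Periodicity {c ℓ₁ ℓ₂ : Level} (P : Poset c ℓ₁ ℓ₂) (t : Poset.Carrier P → Poset.Carrier P)
  (t-mono : ∀ {u v} → Poset._≤_ P u v → Poset._≤_ P (t u) (t v))
  (t-reflect : ∀ {u v} → Poset._≤_ P (t u) (t v) → Poset._≤_ P u v) where

  open Poset P using (Carrier; _≤_) renaming (trans to ≤-trans)
  open ≤-Reasoning P
  open Iteration P t t-mono t-reflect public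
  private module Dual = Iteration (Flip.poset P) t t-mono t-reflect

  Falls : Carrier → Set ℓ₂
  Falls = Dual.Rises

  falls-at : ∀ {n u} → n ≥ 1 → iter n u ≤ u → Falls u
  falls-at = Dual.rises-at

  sandwiched-flip : ∀ {x y} → Sandwiched x y → Dual.Sandwiched x y
  sandwiched-flip (a , e , b , below , above) = b , e , a , above , below

  falls-transfer : ∀ {x y} → Sandwiched x y → Falls x → Falls y
  falls-transfer = Dual.rises-transfer ∘ sandwiched-flip

  falls-reverse : ∀ {u} → Falls u → ∀ n → u ≤ iter n u → iter n u ≤ u
  falls-reverse {u} (m , fall) n u≤ = begin
    iter n u                ≤⟨ iter-mono n (≤-iter-* n u≤ m) ⟩
    iter n (iter (m * n) u) ≡⟨ iter-+ n (m * n) u ⟨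
    iter (suc m * n) u      ≡⟨ cong (λ k → iter k u) (*-comm (suc m) n) ⟩
    iter (n * suc m) u      ≤⟨ Dual.≤-iter-* (suc m) fall n ⟩
    u                       ∎

  periodic-≤-sym : ∀ {u} → Rises u → Falls u → ∀ a b → iter a u ≤ iter b u → iter b u ≤ iter a u
  periodic-≤-sym {u} (m , rise) fall a b a≤b = iter-reflect (a * m) (begin
    iter (a * m) (iter b u) ≡⟨ iter-+ (a * m) b u ⟨
    iter (a * m + b) u      ≤⟨ falls-reverse fall (a * m + b) u≤iter-b ⟩
    u                       ≤⟨ u≤iter-a ⟩
    iter (a * m) (iter a u) ∎)
    where
    u≤iter-a : u ≤ iter (a * m) (iter a u)
    u≤iter-a = begin
      u                       ≤⟨ ≤-iter-* (suc m) rise a ⟩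
      iter (a * suc m) u      ≡⟨ cong (λ k → iter k u) (trans (*-suc a m) (+-comm a (a * m))) ⟩
      iter (a * m + a) u      ≡⟨ iter-+ (a * m) a u ⟩
      iter (a * m) (iter a u) ∎
    u≤iter-b : u ≤ iter (a * m + b) u
    u≤iter-b = begin
      u                       ≤⟨ u≤iter-a ⟩
      iter (a * m) (iter a u) ≤⟨ iter-mono (a * m) a≤b ⟩
      iter (a * m) (iter b u) ≡⟨ iter-+ (a * m) b u ⟨
      iter (a * m + b) u      ∎

  periodic-rise-transfer : ∀ {x y n} → Rises x → Falls x → Sandwiched x y →
                           x ≤ iter n x → y ≤ iter n y
  periodic-rise-transfer {x} {y} {n} rise fall (a , e , b , below , above) x≤ = iter-reflect e (begin
    iter e y          ≤⟨ above ⟩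
    iter b x          ≤⟨ periodic-≤-sym rise fall a b (≤-trans below above) ⟩
    iter a x          ≤⟨ iter-mono a x≤ ⟩
    iter a (iter n x) ≡⟨ iter-comm a n x ⟩
    iter n (iter a x) ≤⟨ iter-mono n below ⟩
    iter n (iter e y) ≡⟨ iter-comm n e y ⟩
    iter e (iter n y) ∎)

data Profile {r s : Level} (R : Set r) (F : Set s) : ℤ → Set (r ⊔ s) where
  rising   : R → ¬ F → Profile R F (+ 1)
  falling  : F → ¬ R → Profile R F -[1+ 0 ]
  balanced : R ⇔ F → Profile R F (+ 0)

profile-unique : ∀ {r s} {R R′ : Set r} {F F′ : Set s} {p q} → R ⇔ R′ → F ⇔ F′ →
                 Profile R F p → Profile R′ F′ q → p ≡ q
profile-unique R⇔ F⇔ (rising _ _)    (rising _ _)      = refl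
profile-unique R⇔ F⇔ (falling _ _)   (falling _ _)     = refl
profile-unique R⇔ F⇔ (balanced _)    (balanced _)      = refl
profile-unique R⇔ F⇔ (rising r _)    (falling _ ¬r′)   = ⊥-elim (¬r′ (Equivalence.to R⇔ r))
profile-unique R⇔ F⇔ (rising r ¬f)   (balanced e′)     =
  ⊥-elim (¬f (Equivalence.from F⇔ (Equivalence.to e′ (Equivalence.to R⇔ r))))
profile-unique R⇔ F⇔ (falling f _)   (rising _ ¬f′)    = ⊥-elim (¬f′ (Equivalence.to F⇔ f))
profile-unique R⇔ F⇔ (falling f ¬r)  (balanced e′)     =
  ⊥-elim (¬r (Equivalence.from R⇔ (Equivalence.from e′ (Equivalence.to F⇔ f))))
profile-unique R⇔ F⇔ (balanced e)    (rising r′ ¬f′)   =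
  ⊥-elim (¬f′ (Equivalence.to F⇔ (Equivalence.to e (Equivalence.from R⇔ r′))))
profile-unique R⇔ F⇔ (balanced e)    (falling f′ ¬r′)  =
  ⊥-elim (¬r′ (Equivalence.to R⇔ (Equivalence.from e (Equivalence.from F⇔ f′))))

LeastPositive : ∀ {ℓ} → (ℕ → Set ℓ) → ℕ → Set ℓ
LeastPositive A n = n ≥ 1 × A n × (∀ m → m ≥ 1 → m < n → ¬ A m)

least-positive-unique : ∀ {ℓ} {A B : ℕ → Set ℓ} {m n} → (∀ k → A k → B k) → (∀ k → B k → A k) →
                        LeastPositive A m → LeastPositive B n → m ≡ n
least-positive-unique {m = m} {n} A⇒B B⇒A (m≥1 , Am , m-least) (n≥1 , Bn , n-least) with <-cmp m n
... | tri< m<n _ _ = ⊥-elim (n-least m m≥1 m<n (A⇒B m Am))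
... | tri≈ _ m≡n _ = m≡n
... | tri> _ _ n<m = ⊥-elim (m-least n n≥1 n<m (B⇒A n Bn))

module Orbits {c ℓ₁ ℓ₂ : Level} (P : Poset c ℓ₁ ℓ₂) (f : Aut P) where

  open Poset P using (Carrier; _≈_; _≤_; antisym; reflexive; module Eq)
  open ≤-Reasoning P
  open Aut f
  open Periodicity P to to-mono to-refl public
  private module Dual = Periodicity (Flip.poset P) to to-mono to-refl

  pow≡iter : ∀ n x → pow f (+ n) x ≡ iter n x
  pow≡iter zero    x = refl
  pow≡iter (suc n) x = cong to (pow≡iter n x)

  iter-cong : ∀ n {u v} → u ≈ v → iter n u ≈ iter n v
  iter-cong n u≈v = antisym (iter-mono n (reflexive u≈v)) (iter-mono n (reflexive (Eq.sym u≈v)))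

  iter-cancels-from : ∀ n x → iter n (iterℕ f from n x) ≈ x
  iter-cancels-from zero    x = Eq.refl
  iter-cancels-from (suc n) x = Eq.trans (Eq.reflexive (iter-comm 1 n (from w)))
                                  (Eq.trans (iter-cong n (to-from w)) (iter-cancels-from n x))
    where
    w : Carrier
    w = iterℕ f from n x

  pow-≤⇒iter-≤ : ∀ {x y} i → pow f i x ≤ y → ∃[ a ] ∃[ c ] iter a x ≤ iter c y
  pow-≤⇒iter-≤ {x} {y} (+ n)    fⁱx≤y = n , 0 , subst (_≤ y) (pow≡iter n x) fⁱx≤y
  pow-≤⇒iter-≤ {x} {y} -[1+ n ] fⁱx≤y = 0 , suc n , (begin
    x                                    ≈⟨ iter-cancels-from (suc n) x ⟨
    iter (suc n) (pow f -[1+ n ] x)      ≤⟨ iter-mono (suc n) fⁱx≤y ⟩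
    iter (suc n) y                       ∎)

  ≤-pow⇒≤-iter : ∀ {x y} j → y ≤ pow f j x → ∃[ d ] ∃[ b ] iter d y ≤ iter b x
  ≤-pow⇒≤-iter {x} {y} (+ n)    y≤fʲx = 0 , n , subst (y ≤_) (pow≡iter n x) y≤fʲx
  ≤-pow⇒≤-iter {x} {y} -[1+ n ] y≤fʲx = suc n , 0 , (begin
    iter (suc n) y                       ≤⟨ iter-mono (suc n) y≤fʲx ⟩
    iter (suc n) (pow f -[1+ n ] x)      ≈⟨ iter-cancels-from (suc n) x ⟩
    x                                    ∎)

  related⇒sandwiched : ∀ {x y} → Related f x y → Sandwiched x y
  related⇒sandwiched (i , j , below , above) = sandwiched (pow-≤⇒iter-≤ i below) (≤-pow⇒≤-iter j above)

  comparable⇒iter : ∀ {x} n → Comparable f x (pow f (+ n) x) → (x ≤ iter n x) ⊎ (iter n x ≤ x)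
  comparable⇒iter {x} n = subst (Comparable f x) (pow≡iter n x)

  iter⇒comparable : ∀ {x} n → (x ≤ iter n x) ⊎ (iter n x ≤ x) → Comparable f x (pow f (+ n) x)
  iter⇒comparable {x} n = subst (Comparable f x) (sym (pow≡iter n x))

  sp∞⇒¬rises : ∀ {x} → Sp f x nothing → ¬ Rises x
  sp∞⇒¬rises never (m , x≤) = never (suc m) (s≤s z≤n) (iter⇒comparable (suc m) (inj₁ x≤))

  sp∞⇒¬falls : ∀ {x} → Sp f x nothing → ¬ Falls x
  sp∞⇒¬falls never (m , ≤x) = never (suc m) (s≤s z≤n) (iter⇒comparable (suc m) (inj₂ ≤x))

  fixed⇒rises×falls : ∀ {x n} → n ≥ 1 → x ≈ pow f (+ n) x → Rises x × Falls x
  fixed⇒rises×falls {x} {n} n≥1 x≈fⁿx with subst (x ≈_) (pow≡iter n x) x≈fⁿx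
  ... | x≈ = rises-at n≥1 (reflexive x≈) , falls-at n≥1 (reflexive (Eq.sym x≈))

  par⇒profile : ∀ {x p} → Par f x p → Profile (Rises x) (Falls x) p
  par⇒profile {x} (par+ n (n≥1 , _) x<fⁿx) with subst (_<P_ f x) (pow≡iter n x) x<fⁿx
  ... | x≤ , x≉ = rising (rises-at n≥1 x≤) (λ fall → x≉ (antisym x≤ (falls-reverse fall n x≤)))
  par⇒profile {x} (par- n (n≥1 , _) fⁿx<x) with subst (λ z → _<P_ f z x) (pow≡iter n x) fⁿx<x
  ... | ≤x , ≉x = falling (falls-at n≥1 ≤x) (λ rise → ≉x (antisym ≤x (Dual.falls-reverse rise n ≤x)))
  par⇒profile (par0-∞ never) = balanced (mk⇔ (⊥-elim ∘ sp∞⇒¬rises never)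
                                             (⊥-elim ∘ sp∞⇒¬falls never))
  par⇒profile (par0-≈ n (n≥1 , _) x≈fⁿx) with fixed⇒rises×falls n≥1 x≈fⁿx
  ... | rise , fall = balanced (mk⇔ (const fall) (const rise))

  parity-transfer : ∀ {x y p q} → Sandwiched x y → Par f x p → Par f y q → p ≡ q
  parity-transfer s parˣ parʸ = profile-unique
    (mk⇔ (rises-transfer s) (rises-transfer (sandwiched-sym s)))
    (mk⇔ (falls-transfer s) (falls-transfer (sandwiched-sym s)))
    (par⇒profile parˣ) (par⇒profile parʸ)

  periodic-comparable-transfer : ∀ {x y} → Rises x → Falls x → Sandwiched x y → ∀ n →
    Comparable f x (pow f (+ n) x) → Comparable f y (pow f (+ n) y)
  periodic-comparable-transfer rise fall s n cmp = iter⇒comparable n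
    ([ inj₁ ∘ periodic-rise-transfer {n = n} rise fall s
     , inj₂ ∘ Dual.periodic-rise-transfer {n = n} fall rise (sandwiched-flip s)
     ]′ (comparable⇒iter n cmp))

  sp-of-¬rises-¬falls : ∀ {x s} → ¬ Rises x → ¬ Falls x → Sp f x s → s ≡ nothing
  sp-of-¬rises-¬falls {s = nothing} _ _ _ = refl
  sp-of-¬rises-¬falls {s = just n} ¬rise ¬fall (n≥1 , cmp , _) =
    ⊥-elim ([ ¬rise ∘ rises-at n≥1 , ¬fall ∘ falls-at n≥1 ]′ (comparable⇒iter n cmp))

  sp-of-rises : ∀ {x s} → Rises x → Sp f x s → ∃[ n ] s ≡ just n × IsSp f x n
  sp-of-rises {s = nothing} rise never = ⊥-elim (sp∞⇒¬rises never rise)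
  sp-of-rises {s = just n} _ sp = n , refl , sp

  spiral-length-transfer : ∀ {x y s t} → Sandwiched x y → Par f x (+ 0) → Sp f x s → Sp f y t → s ≡ t
  spiral-length-transfer s (par0-∞ never) spˣ spʸ = trans (sp-of-¬rises-¬falls ¬rise ¬fall spˣ)
    (sym (sp-of-¬rises-¬falls (¬rise ∘ rises-transfer (sandwiched-sym s))
                              (¬fall ∘ falls-transfer (sandwiched-sym s)) spʸ))
    where
    ¬rise : ¬ Rises _
    ¬rise = sp∞⇒¬rises never
    ¬fall : ¬ Falls _
    ¬fall = sp∞⇒¬falls never
  spiral-length-transfer s (par0-≈ n (n≥1 , _) x≈fⁿx) spˣ spʸ
    with fixed⇒rises×falls n≥1 x≈fⁿx
  ... | riseˣ , fallˣ
    with sp-of-rises riseˣ spˣ | sp-of-rises (rises-transfer s riseˣ) spʸ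
  ... | _ , refl , isSpˣ | _ , refl , isSpʸ = cong just (least-positive-unique
        (periodic-comparable-transfer riseˣ fallˣ s)
        (periodic-comparable-transfer (rises-transfer s riseˣ) (falls-transfer s fallˣ) (sandwiched-sym s))
        isSpˣ isSpʸ)

mainTheorem20 : ∀ {c ℓ₁ ℓ₂ : Level} (P : Poset c ℓ₁ ℓ₂) (f : Aut P)
    (x y : Poset.Carrier P) → Related f x y →
    (∀ (p q : ℤ) → Par f x p → Par f y q → p ≡ q)
    × (∀ (s t : Maybe ℕ) → Par f x (+ 0) → Sp f x s → Sp f y t → s ≡ t)
mainTheorem20 P f x y x∼y =
  (λ _ _ → parity-transfer sandwich) , (λ _ _ → spiral-length-transfer sandwich)
  where
  open Orbits P f
  sandwich : Sandwiched x y
  sandwich = related⇒sandwiched x∼y
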